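{- Let $G$ be a finite simple undirected graph and let $K_1,K_2$ be nonempty induced subgraphs of $G$ with $V(G)=V(K_1)\cup V(K_2)$ and $V(K_1)\cap V(K_2)=\emptyset$. Suppose there are vertices $a\in V(K_1)$ and $b\in V(K_2)$ such that $\{a,b\}\in E(G)$, every vertex of $K_1$ is adjacent to $b$, and every vertex of $K_2$ is adjacent to $a$. Then $\mathcal{H}^{\mathrm{Path}}_n(G)\cong\mathcal{H}^{\mathrm{Cube}}_n(G)\cong(0)$ for all $n>0$.
   Context: $R$ is a commutative ring with unit; graphs are finite, simple and undirected. A graph homomorphism is a vertex map sending adjacent vertices to equal or adjacent vertices. $Q_n$ is the graph on $\{0,1\}^n$ with edges between vertices at Hamming distance one ($Q_0$ a single vertex). Discrete cubical homology $\mathcal{H}^{\mathrm{Cube}}_\bullet(G)$: a singular $n$-cube is a graph homomorphism $\sigma: Q_n\to G$; $\mathcal{L}^{\mathrm{Cube}}_n(G)$ is the free $R$-module on them. For $n\ge1$, $i\in[n]$: $f_i^{\pm}\sigma(a_1,\dots,a_{n-1})=\sigma(a_1,\dots,a_{i-1},\epsilon,a_i,\dots,a_{n-1})$ with $\epsilon=1$ for $+$, $\epsilon=0$ for $-$. $\sigma$ is degenerate if $f_i^+\sigma=f_i^-\sigma$ for some $i$. $\mathcal{C}^{\mathrm{Cube}}_n(G)$ is $\mathcal{L}^{\mathrm{Cube}}_n(G)$ modulo degenerate cubes, with $\partial_n\sigma=\sum_{i=1}^n(-1)^i(f_i^-\sigma-f_i^+\sigma)$, $\partial_0=0$; $\mathcal{H}^{\mathrm{Cube}}_n(G)$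 is its homology. Path homology $\mathcal{H}^{\mathrm{Path}}_\bullet(G)$: $\mathcal{C}_n(V)$ is the free $R$-module on $(n+1)$-tuples of vertices modulo tuples with $v_i=v_{i+1}$ for some $i$, with $\partial_n(v_0,\dots,v_n)=\sum_{i=0}^n(-1)^i(v_0,\dots,\widehat{v_i},\dots,v_n)$, $\partial_0=0$. $\widetilde{\mathcal{C}}_n(G)\subseteq\mathcal{C}_n(V)$ is generated by allowed paths (tuples with $\{v_i,v_{i+1}\}\in E(G)$ for all $i$), $\widetilde{\mathcal{C}}_{ -1}=0$; $\mathcal{C}^{\mathrm{Path}}_n(G)=\{x\in\widetilde{\mathcal{C}}_n(G):\partial_nx\in\widetilde{\mathcal{C}}_{n-1}(G)\}$ and $\mathcal{H}^{\mathrm{Path}}_n(G)$ is its homology. -}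

module Defs where

import Level
open import Data.Nat using (ℕ; zero; suc)
import Data.Nat as Nat
open import Data.Fin using (Fin; toℕ)
open import Data.Fin.Properties using (_≟_)
open import Data.Bool using (Bool; true; false; if_then_else_; _∧_)
open import Data.Vec using (Vec; []; _∷_; insertAt; removeAt)
open import Data.Vec.Properties using (≡-dec)
open import Data.List using (List; []; _∷_; _++_; concatMap; map; allFin)
open import Data.List.Relation.Unary.All using (All)
open import Data.Product using (Σ; ∃; _×_; _,_; proj₁; proj₂)
open import Data.Sum using (_⊎_)
open import Data.Unit using (⊤)
open import Data.Empty using (⊥)
open import Relation.Binary.PropositionalEquality using (_≡_; _≢_)
open import Relation.Nullary using (¬_; Dec)
open import Relation.Nullary.Decidable using (⌊_⌋)
open import Algebra.Bundles using (CommutativeRing)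
open import Data.Fin.Subset using (Subset; _∈_)

record Graph : Set₁ where
  field
    N          : ℕ
    Adj        : Fin N → Fin N → Set
    adj?       : ∀ u v → Dec (Adj u v)
    adj-sym    : ∀ {u v} → Adj u v → Adj v u
    adj-irrefl : ∀ {v} → ¬ Adj v v

hamming : ∀ {n} → Vec Bool n → Vec Bool n → ℕ
hamming []       []       = 0
hamming (x ∷ xs) (y ∷ ys) = (if ⌊ Data.Bool._≟_ x y ⌋ then 0 else 1) Nat.+ hamming xs ys

QAdj : ∀ {n} → Vec Bool n → Vec Bool n → Set
QAdj x y = hamming x y ≡ 1

allBits : (n : ℕ) → List (Vec Bool n)
allBits zero    = [] ∷ []
allBits (suc n) = map (false ∷_) (allBits n) ++ map (true ∷_) (allBits n)

-- Chains are finite formal R-linear combinations (lists of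
-- (coefficient, generator)); two chains are equal in the quotient
-- module iff their total coefficients agree at every non-degenerate
-- (resp. regular) generator.

allTrue : ∀ {a} {X : Set a} → (X → Bool) → List X → Bool
allTrue p []       = true
allTrue p (x ∷ xs) = p x ∧ allTrue p xs

module Homology {c ℓ} (R : CommutativeRing c ℓ) (G : Graph) where
  open CommutativeRing R renaming (Carrier to A)
  open Graph G

  V : Set
  V = Fin N

  CMap : ℕ → Set
  CMap n = Vec Bool n → V

  IsHom : ∀ {n} → CMap n → Set
  IsHom σ = ∀ x y → QAdj x y → (σ x ≡ σ y) ⊎ Adj (σ x) (σ y)

  -- face f_{j+1}^ε (j : Fin n is the 0-based index i - 1)
  face : ∀ {m} → Fin (suc m) → Bool → CMap (suc m) → CMap m
  face j ε σ a = σ (insertAt a j ε)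

  Degenerate : ∀ {n} → CMap n → Set
  Degenerate {zero}  σ = ⊥
  Degenerate {suc m} σ = Σ (Fin (suc m)) λ j → ∀ a → face j true σ a ≡ face j false σ a

  sameMap : ∀ {n} → CMap n → CMap n → Bool
  sameMap {n} σ τ = allTrue (λ x → ⌊ σ x ≟ τ x ⌋) (allBits n)

  -- element of L^Cube_n(G): formal combination of maps, all of which
  -- are required to be homomorphisms (see CubeChain)
  CChain : ℕ → Set c
  CChain n = List (A × CMap n)

  CubeChain : ∀ {n} → CChain n → Set c
  CubeChain = All (λ p → IsHom (proj₂ p))

  coeffC : ∀ {n} → CChain n → CMap n → A
  coeffC []             τ = 0#
  coeffC ((r , σ) ∷ cs) τ = (if sameMap σ τ then r else 0#) + coeffC cs τ

  -- sgn k = (-1)^(k+1)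
  sgn : ℕ → A
  sgn zero    = - 1#
  sgn (suc k) = - sgn k

  -- ∂_n σ = Σ_{i=1}^n (-1)^i (f_i^- σ - f_i^+ σ)
  ∂C : ∀ {m} → CChain (suc m) → CChain m
  ∂C {m} = concatMap λ p →
    concatMap (λ j → (sgn (toℕ j) * proj₁ p , face j false (proj₂ p))
                   ∷ (- (sgn (toℕ j) * proj₁ p) , face j true (proj₂ p)) ∷ [])
              (allFin (suc m))

  -- equality in C^Cube_n(G) = L^Cube_n(G) / degenerate cubes
  _≈C_ : ∀ {n} → CChain n → CChain n → Set ℓ
  _≈C_ {n} x y = ∀ (τ : CMap n) → IsHom τ → ¬ Degenerate τ → coeffC x τ ≈ coeffC y τ

  CubeHomologyVanishes : ℕ → Set (c Level.⊔ ℓ)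
  CubeHomologyVanishes m =
    ∀ (x : CChain (suc m)) → CubeChain x → ∂C x ≈C [] →
      Σ (CChain (suc (suc m))) λ y → CubeChain y × (∂C y ≈C x)

  PChain : ℕ → Set c
  PChain n = List (A × Vec V (suc n))

  -- tuples with no two consecutive entries equal (the basis of C_n(V))
  Regular : ∀ {k} → Vec V k → Set
  Regular []           = ⊤
  Regular (x ∷ [])     = ⊤
  Regular (x ∷ y ∷ xs) = (x ≢ y) × Regular (y ∷ xs)

  Allowed : ∀ {k} → Vec V k → Set
  Allowed []           = ⊤
  Allowed (x ∷ [])     = ⊤
  Allowed (x ∷ y ∷ xs) = Adj x y × Allowed (y ∷ xs)

  coeffP : ∀ {n} → PChain n → Vec V (suc n) → A
  coeffP []             t = 0#
  coeffP ((r , v) ∷ cs) t = (if ⌊ ≡-dec _≟_ v t ⌋ then r else 0#) + coeffP cs t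

  psgn : ℕ → A
  psgn zero    = 1#
  psgn (suc k) = - psgn k

  ∂P : ∀ {m} → PChain (suc m) → PChain m
  ∂P {m} = concatMap λ p →
    map (λ j → (psgn (toℕ j) * proj₁ p , removeAt (proj₂ p) j)) (allFin (suc (suc m)))

  -- equality in C_n(V) (quotient by non-regular tuples)
  _≈P_ : ∀ {n} → PChain n → PChain n → Set ℓ
  _≈P_ {n} x y = ∀ (t : Vec V (suc n)) → Regular t → coeffP x t ≈ coeffP y t

  -- membership in the submodule C~_n(G) generated by allowed paths
  InAllowed : ∀ {n} → PChain n → Set ℓ
  InAllowed {n} x = ∀ (t : Vec V (suc n)) → Regular t → ¬ Allowed t → coeffP x t ≈ 0#

  InPath : ∀ {m} → PChain (suc m) → Set ℓ
  InPath x = InAllowed x × InAllowed (∂P x)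

  PathHomologyVanishes : ℕ → Set (c Level.⊔ ℓ)
  PathHomologyVanishes m =
    ∀ (x : PChain (suc m)) → InPath x → ∂P x ≈P [] →
      Σ (PChain (suc (suc m))) λ y → InPath y × (∂P y ≈P x)

-- Send the vertices of K₁ to b and all others to a. The resulting map φ is a graph
-- map, every v is equal or adjacent to φ v, and a is equal or adjacent to every φ v:
-- φ is one step away from the identity and one step away from the constant map at a.
-- Each step gives an explicit chain homotopy, a prism for path chains and a cylinder
-- in a new first coordinate for cubical chains; together they yield an operator Y
-- with ∂Y + Y∂ = id in positive degrees (up to a degenerate constant cube). Y sends
-- irregular tuples to irregular ones, degenerate cubes to degenerate ones and walks to
-- walks, so it respects the quotients and the allowed-path condition, and every
-- positive-degree cycle x is the boundary of Y x.
module Submission where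

open import Defs
open import Data.Nat using (ℕ; suc)
open import Data.Fin using (Fin)
open import Data.Fin.Subset using (Subset; _∈_)
open import Data.Product using (_×_)
open import Data.Sum using (_⊎_)
open import Relation.Nullary using (¬_)
open import Algebra.Bundles using (CommutativeRing)

open import Level using (0ℓ; _⊔_)
open import Data.Nat as ℕ using (zero; s≤s)
import Data.Nat.Properties as ℕ
open import Data.Fin using (zero; suc; toℕ)
open import Data.Fin.Properties using (_≟_; any?)
open import Data.Fin.Subset.Properties using (_∈?_)
open import Data.Product using (_,_; proj₁; proj₂)
open import Data.Sum using (inj₁; inj₂; [_,_])
open import Data.Bool using (Bool; true; false; T; if_then_else_)
open import Data.Bool.Properties using (T-∧)
open import Data.Maybe using (Maybe; just; nothing)
open import Data.Unit using (⊤; tt)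
open import Data.Empty using (⊥; ⊥-elim)
open import Data.List using (List; []; _∷_; _++_; concatMap; length; map; filter; tabulate; allFin)
import Data.List.Properties as List
import Data.List.Membership.Propositional as Membership
open import Data.List.Membership.Propositional.Properties using (∈-map⁺; ∈-++⁺ˡ; ∈-++⁺ʳ)
open import Data.List.Relation.Unary.Any using (here; there)
open import Data.List.Relation.Unary.All as All using (All; []; _∷_)
import Data.List.Relation.Unary.All.Properties as All
open import Data.Vec as Vec using (Vec; []; _∷_; insertAt; removeAt)
open import Data.Vec.Properties using (≡-dec)
open import Function using (_∘_; id; const; flip; Equivalence)
open import Relation.Binary.PropositionalEquality as ≡ using (_≡_; _≗_)
open import Relation.Binary.PropositionalEquality.Properties using (decSetoid)
open import Relation.Binary.Bundles using (DecSetoid)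
open import Relation.Nullary using (Dec; does; yes; no; ¬?; contradiction; map′; _×-dec_)
open import Relation.Nullary.Decidable using (T?; ⌊_⌋; toWitness; fromWitness; isYes≗does; dec-true; dec-false)
open import Relation.Unary using (Decidable)
open import Algebra.Bundles using (RawRing)
import Algebra.Solver.Ring.AlmostCommutativeRing as ACR

module IntegerCoefficientSolver {c ℓ} (R : CommutativeRing c ℓ) where

  open CommutativeRing R
  open import Algebra.Properties.Semiring.Mult semiring using (×-homo-+; ×1-homo-*) renaming (_×_ to _·_)
  open import Algebra.Properties.Ring ring using (x[y-z]≈xy-xz; [y-z]x≈yx-zx)
  open import Algebra.Properties.AbelianGroup +-abelianGroup using (⁻¹-∙-comm; ⁻¹-anti-homo‿-)
  open import Algebra.Properties.Group +-group using (ε⁻¹≈ε)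
  open import Relation.Binary.Reasoning.Setoid setoid

  -- Algebra.Solver.Ring needs coefficients with decidable equality; over an arbitrary
  -- commutative ring these are the integers, acting by n ↦ n · 1#. The pair (p , n)
  -- stands for p - n and is kept with one component zero, so equal integers have
  -- identical representations and normal forms can be compared by refl.
  ℤ₂ : Set
  ℤ₂ = ℕ × ℕ

  normalise : ℤ₂ → ℤ₂
  normalise (p , n) = (p ℕ.∸ n , n ℕ.∸ p)

  coefficients : RawRing _ _
  coefficients = record
    { Carrier = ℤ₂ ; _≈_ = _≡_
    ; _+_ = λ { (p , n) (p′ , n′) → normalise (p ℕ.+ p′ , n ℕ.+ n′) }
    ; _*_ = λ { (p , n) (p′ , n′) → normalise (p ℕ.* p′ ℕ.+ n ℕ.* n′ , p ℕ.* n′ ℕ.+ n ℕ.* p′) }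
    ; -_ = λ { (p , n) → (n , p) }
    ; 0# = (0 , 0) ; 1# = (1 , 0) }

  ⟦_⟧ : ℤ₂ → Carrier
  ⟦ p , n ⟧ = p · 1# - n · 1#

  -[+]≈- : ∀ a b c d → (a + b) - (c + d) ≈ (a - c) + (b - d)
  -[+]≈- a b c d = begin
    (a + b) - (c + d)     ≈⟨ +-congˡ (sym (⁻¹-∙-comm c d)) ⟩
    (a + b) + (- c + - d) ≈⟨ +-assoc a b _ ⟩
    a + (b + (- c + - d)) ≈⟨ +-congˡ (sym (+-assoc b (- c) (- d))) ⟩
    a + ((b - c) + - d)   ≈⟨ +-congˡ (+-congʳ (+-comm b (- c))) ⟩
    a + ((- c + b) + - d) ≈⟨ +-congˡ (+-assoc (- c) b (- d)) ⟩
    a + (- c + (b - d))   ≈⟨ sym (+-assoc a (- c) _) ⟩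
    (a - c) + (b - d)     ∎

  ⟦normalise⟧ : ∀ x → ⟦ normalise x ⟧ ≈ ⟦ x ⟧
  ⟦normalise⟧ (zero  , zero)  = refl
  ⟦normalise⟧ (zero  , suc n) = refl
  ⟦normalise⟧ (suc p , zero)  = refl
  ⟦normalise⟧ (suc p , suc n) = begin
    ⟦ normalise (p , n) ⟧             ≈⟨ ⟦normalise⟧ (p , n) ⟩
    p · 1# - n · 1#                   ≈⟨ sym (+-identityˡ _) ⟩
    0# + (p · 1# - n · 1#)            ≈⟨ +-congʳ (sym (-‿inverseʳ 1#)) ⟩
    (1# - 1#) + (p · 1# - n · 1#)     ≈⟨ sym (-[+]≈- 1# _ 1# _) ⟩
    (1# + p · 1#) - (1# + n · 1#)     ∎

  homomorphism : coefficients ACR.-Raw-AlmostCommutative⟶ ACR.fromCommutativeRing R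
  homomorphism = record
    { ⟦_⟧    = ⟦_⟧
    ; +-homo = +-homo
    ; *-homo = *-homo
    ; -‿homo = λ { (p , n) → sym (⁻¹-anti-homo‿- (p · 1#) (n · 1#)) }
    ; 0-homo = trans (+-congˡ ε⁻¹≈ε) (+-identityʳ 0#)
    ; 1-homo = trans (+-cong (+-identityʳ 1#) ε⁻¹≈ε) (+-identityʳ 1#)
    }
    where
    +-homo : ∀ x y → ⟦ RawRing._+_ coefficients x y ⟧ ≈ ⟦ x ⟧ + ⟦ y ⟧
    +-homo (p , n) (p′ , n′) = begin
      ⟦ normalise (p ℕ.+ p′ , n ℕ.+ n′) ⟧          ≈⟨ ⟦normalise⟧ (p ℕ.+ p′ , n ℕ.+ n′) ⟩
      (p ℕ.+ p′) · 1# - (n ℕ.+ n′) · 1#             ≈⟨ +-cong (×-homo-+ 1# p p′) (-‿cong (×-homo-+ 1# n n′)) ⟩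
      (p · 1# + p′ · 1#) - (n · 1# + n′ · 1#)       ≈⟨ -[+]≈- _ _ _ _ ⟩
      ⟦ p , n ⟧ + ⟦ p′ , n′ ⟧                       ∎
    *-homo : ∀ x y → ⟦ RawRing._*_ coefficients x y ⟧ ≈ ⟦ x ⟧ * ⟦ y ⟧
    *-homo (p , n) (p′ , n′) = begin
      ⟦ normalise (p ℕ.* p′ ℕ.+ n ℕ.* n′ , p ℕ.* n′ ℕ.+ n ℕ.* p′) ⟧
        ≈⟨ ⟦normalise⟧ (p ℕ.* p′ ℕ.+ n ℕ.* n′ , p ℕ.* n′ ℕ.+ n ℕ.* p′) ⟩
      (p ℕ.* p′ ℕ.+ n ℕ.* n′) · 1# - (p ℕ.* n′ ℕ.+ n ℕ.* p′) · 1#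
        ≈⟨ +-cong (trans (×-homo-+ 1# (p ℕ.* p′) _) (+-cong (×1-homo-* p p′) (×1-homo-* n n′)))
                  (-‿cong (trans (×-homo-+ 1# (p ℕ.* n′) _) (+-cong (×1-homo-* p n′) (×1-homo-* n p′)))) ⟩
      (P * P′ + N * N′) - (P * N′ + N * P′) ≈⟨ -[+]≈- _ _ _ _ ⟩
      (P * P′ - P * N′) + (N * N′ - N * P′) ≈⟨ +-congˡ (sym (⁻¹-anti-homo‿- (N * P′) (N * N′))) ⟩
      (P * P′ - P * N′) - (N * P′ - N * N′) ≈⟨ sym (+-cong (x[y-z]≈xy-xz P P′ N′) (-‿cong (x[y-z]≈xy-xz N P′ N′))) ⟩
      P * (P′ - N′) - N * (P′ - N′)         ≈⟨ sym ([y-z]x≈yx-zx (P′ - N′) P N) ⟩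
      (P - N) * (P′ - N′)                   ∎
      where
      P N P′ N′ : Carrier
      P = p · 1#
      N = n · 1#
      P′ = p′ · 1#
      N′ = n′ · 1#

  _≟ℤ₂_ : ∀ x y → Maybe (⟦ x ⟧ ≈ ⟦ y ⟧)
  (p , n) ≟ℤ₂ (p′ , n′) with p ℕ.≟ p′ | n ℕ.≟ n′
  ... | yes ≡.refl | yes ≡.refl = just refl
  ... | _        | _        = nothing

  open import Algebra.Solver.Ring coefficients (ACR.fromCommutativeRing R) homomorphism _≟ℤ₂_ public
    using (solve; _:=_; _:+_; _:*_; _:-_; :-_)

module FormalSums {c ℓ} (R : CommutativeRing c ℓ) where

  open CommutativeRing R
  open import Algebra.Properties.Group +-group using (ε⁻¹≈ε)
  open IntegerCoefficientSolver R
  open import Relation.Binary.Reasoning.Setoid setoid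

  FormalSum : Set → Set c
  FormalSum X = List (Carrier × X)

  -- Chains are evaluated against weights (cochains); operators on chains are handled
  -- through their transposes, e.g. ⟪ ∂P x ⟫ g ≈ ⟪ x ⟫ (δ g).
  ⟪_⟫ : ∀ {X : Set} → FormalSum X → (X → Carrier) → Carrier
  ⟪ [] ⟫           g = 0#
  ⟪ (r , σ) ∷ xs ⟫ g = r * g σ + ⟪ xs ⟫ g

  AllGen : ∀ {X : Set} {p} → (X → Set p) → FormalSum X → Set (c ⊔ p)
  AllGen Q = All (Q ∘ proj₂)

  scale : ∀ {X : Set} → Carrier → FormalSum X → FormalSum X
  scale k = map (λ (r , σ) → (k * r , σ))

  rename : ∀ {X Y : Set} → (X → Y) → FormalSum X → FormalSum Y
  rename f = map (λ (r , σ) → (r , f σ))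

  bind : ∀ {X Y : Set} → (X → FormalSum Y) → FormalSum X → FormalSum Y
  bind F = concatMap (λ (r , σ) → scale r (F σ))

  module _ {X : Set} where

    ⟪⟫-++ : ∀ (xs ys : FormalSum X) g → ⟪ xs ++ ys ⟫ g ≈ ⟪ xs ⟫ g + ⟪ ys ⟫ g
    ⟪⟫-++ []             ys g = sym (+-identityˡ _)
    ⟪⟫-++ ((r , σ) ∷ xs) ys g = trans (+-congˡ (⟪⟫-++ xs ys g)) (sym (+-assoc _ _ _))

    ⟪⟫-cong-All : ∀ (xs : FormalSum X) {g h} → AllGen (λ σ → g σ ≈ h σ) xs → ⟪ xs ⟫ g ≈ ⟪ xs ⟫ h
    ⟪⟫-cong-All []             []       = refl
    ⟪⟫-cong-All ((r , σ) ∷ xs) (e ∷ es) = +-cong (*-congˡ e) (⟪⟫-cong-All xs es)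

    ⟪⟫-cong : ∀ (xs : FormalSum X) {g h} → (∀ σ → g σ ≈ h σ) → ⟪ xs ⟫ g ≈ ⟪ xs ⟫ h
    ⟪⟫-cong xs e = ⟪⟫-cong-All xs (All.universal (e ∘ proj₂) xs)

    ⟪⟫-+ : ∀ (xs : FormalSum X) g h → ⟪ xs ⟫ (λ σ → g σ + h σ) ≈ ⟪ xs ⟫ g + ⟪ xs ⟫ h
    ⟪⟫-+ []             g h = sym (+-identityˡ _)
    ⟪⟫-+ ((r , σ) ∷ xs) g h = trans (+-congˡ (⟪⟫-+ xs g h))
      (solve 5 (λ r a b u v → r :* (a :+ b) :+ (u :+ v) := (r :* a :+ u) :+ (r :* b :+ v)) refl r (g σ) (h σ) _ _)

    ⟪⟫-neg : ∀ (xs : FormalSum X) g → ⟪ xs ⟫ (λ σ → - g σ) ≈ - ⟪ xs ⟫ g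
    ⟪⟫-neg []             g = sym ε⁻¹≈ε
    ⟪⟫-neg ((r , σ) ∷ xs) g = trans (+-congˡ (⟪⟫-neg xs g))
      (solve 3 (λ r a u → r :* (:- a) :+ (:- u) := :- (r :* a :+ u)) refl r (g σ) _)

    ⟪⟫-sub : ∀ (xs : FormalSum X) g h → ⟪ xs ⟫ (λ σ → g σ - h σ) ≈ ⟪ xs ⟫ g - ⟪ xs ⟫ h
    ⟪⟫-sub xs g h = trans (⟪⟫-+ xs g (λ σ → - h σ)) (+-congˡ (⟪⟫-neg xs h))

    ⟪⟫-*ʳ : ∀ (xs : FormalSum X) g k → ⟪ xs ⟫ (λ σ → g σ * k) ≈ ⟪ xs ⟫ g * k
    ⟪⟫-*ʳ []             g k = sym (zeroˡ k)
    ⟪⟫-*ʳ ((r , σ) ∷ xs) g k = trans (+-congˡ (⟪⟫-*ʳ xs g k))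
      (solve 4 (λ r a k u → r :* (a :* k) :+ u :* k := (r :* a :+ u) :* k) refl r (g σ) k _)

    ⟪⟫-zero : ∀ (xs : FormalSum X) {g} → AllGen (λ σ → g σ ≈ 0#) xs → ⟪ xs ⟫ g ≈ 0#
    ⟪⟫-zero []             []       = refl
    ⟪⟫-zero ((r , σ) ∷ xs) (z ∷ zs) =
      trans (+-cong (trans (*-congˡ z) (zeroʳ r)) (⟪⟫-zero xs zs)) (+-identityʳ 0#)

    ⟪⟫-scale : ∀ k (xs : FormalSum X) g → ⟪ scale k xs ⟫ g ≈ k * ⟪ xs ⟫ g
    ⟪⟫-scale k []             g = sym (zeroʳ k)
    ⟪⟫-scale k ((r , σ) ∷ xs) g = trans (+-congˡ (⟪⟫-scale k xs g))
      (solve 4 (λ k r a u → k :* r :* a :+ k :* u := k :* (r :* a :+ u)) refl k r (g σ) _)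

    AllGen-scale : ∀ {p} {Q : X → Set p} k {xs} → AllGen Q xs → AllGen Q (scale k xs)
    AllGen-scale k = All.map⁺

    ⟪⟫-filter : ∀ {p} {P : Carrier × X → Set p} (P? : Decidable P) xs g →
      ⟪ xs ⟫ g ≈ ⟪ filter P? xs ⟫ g + ⟪ filter (¬? ∘ P?) xs ⟫ g
    ⟪⟫-filter P? []       g = sym (+-identityˡ 0#)
    ⟪⟫-filter P? (x ∷ xs) g with P? x
    ... | yes _ = trans (+-congˡ (⟪⟫-filter P? xs g)) (sym (+-assoc _ _ _))
    ... | no  _ = trans (+-congˡ (⟪⟫-filter P? xs g))
      (solve 3 (λ a u v → a :+ (u :+ v) := u :+ (a :+ v)) refl _ _ _)

  module _ {X Y : Set} where

    ⟪⟫-rename : ∀ (f : X → Y) (xs : FormalSum X) g → ⟪ rename f xs ⟫ g ≡ ⟪ xs ⟫ (g ∘ f)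
    ⟪⟫-rename f []             g = ≡.refl
    ⟪⟫-rename f ((r , σ) ∷ xs) g = ≡.cong (r * g (f σ) +_) (⟪⟫-rename f xs g)

    ⟪⟫-bind : ∀ (F : X → FormalSum Y) (xs : FormalSum X) g → ⟪ bind F xs ⟫ g ≈ ⟪ xs ⟫ (λ σ → ⟪ F σ ⟫ g)
    ⟪⟫-bind F []             g = refl
    ⟪⟫-bind F ((r , σ) ∷ xs) g =
      trans (⟪⟫-++ (scale r (F σ)) _ g) (+-cong (⟪⟫-scale r (F σ) g) (⟪⟫-bind F xs g))

    AllGen-rename : ∀ {p q} {P : X → Set p} {Q : Y → Set q} {f : X → Y} →
      (∀ {σ} → P σ → Q (f σ)) → ∀ {xs} → AllGen P xs → AllGen Q (rename f xs)
    AllGen-rename P⇒Q = All.map⁺ ∘ All.map P⇒Q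

    AllGen-bind : ∀ {p q} {P : X → Set p} {Q : Y → Set q} {F : X → FormalSum Y} →
      (∀ {σ} → P σ → AllGen Q (F σ)) → ∀ {xs} → AllGen P xs → AllGen Q (bind F xs)
    AllGen-bind P⇒Q []       = []
    AllGen-bind P⇒Q (p ∷ ps) = All.++⁺ (AllGen-scale _ (P⇒Q p)) (AllGen-bind P⇒Q ps)

  𝟙[_] : ∀ {p} {P : Set p} → Dec P → Carrier
  𝟙[ d ] = if does d then 1# else 0#

  𝟙-yes : ∀ {p} {P : Set p} (d : Dec P) → P → 𝟙[ d ] ≈ 1#
  𝟙-yes d p rewrite dec-true d p = refl

  𝟙-no : ∀ {p} {P : Set p} (d : Dec P) → ¬ P → 𝟙[ d ] ≈ 0#
  𝟙-no d ¬p rewrite dec-false d ¬p = refl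

  if-then-0≈*𝟙 : ∀ {p} {P : Set p} (d : Dec P) r → (if does d then r else 0#) ≈ r * 𝟙[ d ]
  if-then-0≈*𝟙 d r with does d
  ... | true  = sym (*-identityʳ r)
  ... | false = sym (zeroʳ r)

  module Coefficients (S : DecSetoid 0ℓ 0ℓ) where

    open DecSetoid S using ()
      renaming (Carrier to X; _≈_ to _∼_; _≟_ to _∼?_; refl to ∼-refl; sym to ∼-sym; trans to ∼-trans)

    coeff : FormalSum X → X → Carrier
    coeff xs τ = ⟪ xs ⟫ (λ σ → 𝟙[ σ ∼? τ ])

    Respects : (X → Carrier) → Set ℓ
    Respects h = ∀ {σ σ′} → σ ∼ σ′ → h σ ≈ h σ′

    𝟙-resp : ∀ τ → Respects (λ σ → 𝟙[ σ ∼? τ ])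
    𝟙-resp τ {σ} {σ′} σ∼σ′ with σ ∼? τ
    ... | yes σ∼τ = sym (𝟙-yes (σ′ ∼? τ) (∼-trans (∼-sym σ∼σ′) σ∼τ))
    ... | no ¬σ∼τ = sym (𝟙-no (σ′ ∼? τ) (¬σ∼τ ∘ ∼-trans σ∼σ′))

    coeff-outside : ∀ {p} {Q : X → Set p} → (∀ {σ τ} → σ ∼ τ → Q σ → Q τ) →
      ∀ xs {τ} → AllGen Q xs → ¬ Q τ → coeff xs τ ≈ 0#
    coeff-outside Q-resp xs Qs ¬Qτ = ⟪⟫-zero xs (All.map (λ Qσ → 𝟙-no (_ ∼? _) (¬Qτ ∘ flip Q-resp Qσ)) Qs)

    ⟪⟫-on-class : ∀ {s} ys h → Respects h → AllGen (s ∼_) ys → ⟪ ys ⟫ h ≈ coeff ys s * h s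
    ⟪⟫-on-class {s} ys h h-resp in-class = begin
      ⟪ ys ⟫ h                             ≈⟨ ⟪⟫-cong-All ys (All.map h≈𝟙*h in-class) ⟩
      ⟪ ys ⟫ (λ σ → 𝟙[ σ ∼? s ] * h s)     ≈⟨ ⟪⟫-*ʳ ys _ (h s) ⟩
      coeff ys s * h s                     ∎
      where
      h≈𝟙*h : ∀ {σ} → s ∼ σ → h σ ≈ 𝟙[ σ ∼? s ] * h s
      h≈𝟙*h s∼σ = trans (h-resp (∼-sym s∼σ)) (sym (trans (*-congʳ (𝟙-yes (_ ∼? s) (∼-sym s∼σ))) (*-identityˡ _)))

    VanishesOnSupport : (X → Carrier) → FormalSum X → Set (c ⊔ ℓ)
    VanishesOnSupport h xs = AllGen (λ σ → coeff xs σ ≈ 0# ⊎ h σ ≈ 0#) xs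

    -- Split off the entries equivalent to the first one: together they contribute
    -- (their total coefficient) * h s, which vanishes; the rest is shorter.
    private
      ⟪⟫≈0-bounded : ∀ n xs h → length xs ℕ.≤ n → Respects h → VanishesOnSupport h xs → ⟪ xs ⟫ h ≈ 0#
      ⟪⟫≈0-bounded _ [] h _ _ _ = refl
      ⟪⟫≈0-bounded (suc n) ((r , s) ∷ xs) h (s≤s len) h-resp (hyp₀ ∷ hyp) = begin
        r * h s + ⟪ xs ⟫ h                      ≈⟨ +-congˡ (⟪⟫-filter same? xs h) ⟩
        r * h s + (⟪ same ⟫ h + ⟪ others ⟫ h)   ≈⟨ sym (+-assoc _ _ _) ⟩
        (r * h s + ⟪ same ⟫ h) + ⟪ others ⟫ h   ≈⟨ +-cong class-of-s vanish-others ⟩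
        0# + 0#                                 ≈⟨ +-identityʳ 0# ⟩
        0#                                      ∎
        where
        same? : Decidable (λ (p : Carrier × X) → s ∼ proj₂ p)
        same? (_ , σ) = s ∼? σ
        same others : FormalSum X
        same   = filter same? xs
        others = filter (¬? ∘ same?) xs
        in-same : AllGen (s ∼_) same
        in-same = All.all-filter same? xs
        in-others : AllGen (λ σ → ¬ s ∼ σ) others
        in-others = All.all-filter (¬? ∘ same?) xs
        s∼-resp : ∀ {σ τ} → σ ∼ τ → s ∼ σ → s ∼ τ
        s∼-resp σ∼τ s∼σ = ∼-trans s∼σ σ∼τ
        s≁-resp : ∀ {σ τ} → σ ∼ τ → ¬ s ∼ σ → ¬ s ∼ τ
        s≁-resp σ∼τ ¬s∼σ = ¬s∼σ ∘ s∼-resp (∼-sym σ∼τ)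

        coeff-s : coeff ((r , s) ∷ xs) s ≈ r + coeff same s
        coeff-s = begin
          r * 𝟙[ s ∼? s ] + coeff xs s               ≈⟨ +-cong (*-congˡ (𝟙-yes (s ∼? s) ∼-refl)) (⟪⟫-filter same? xs _) ⟩
          r * 1# + (coeff same s + coeff others s)   ≈⟨ +-cong (*-identityʳ r) (+-congˡ
                                                          (coeff-outside s≁-resp others in-others (λ ¬s∼s → ¬s∼s ∼-refl))) ⟩
          r + (coeff same s + 0#)                    ≈⟨ +-congˡ (+-identityʳ _) ⟩
          r + coeff same s                           ∎

        class-of-s : r * h s + ⟪ same ⟫ h ≈ 0#
        class-of-s = begin
          r * h s + ⟪ same ⟫ h                ≈⟨ +-congˡ (⟪⟫-on-class same h h-resp in-same) ⟩
          r * h s + coeff same s * h s        ≈⟨ sym (distribʳ (h s) r _) ⟩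
          (r + coeff same s) * h s            ≈⟨ *-congʳ (sym coeff-s) ⟩
          coeff ((r , s) ∷ xs) s * h s
            ≈⟨ [ (λ c≈0 → trans (*-congʳ c≈0) (zeroˡ _)) , (λ h≈0 → trans (*-congˡ h≈0) (zeroʳ _)) ] hyp₀ ⟩
          0#                                  ∎

        coeff-others : ∀ {σ} → ¬ s ∼ σ → coeff others σ ≈ coeff ((r , s) ∷ xs) σ
        coeff-others {σ} ¬s∼σ = sym (begin
          r * 𝟙[ s ∼? σ ] + coeff xs σ               ≈⟨ +-cong (*-congˡ (𝟙-no (s ∼? σ) ¬s∼σ)) (⟪⟫-filter same? xs _) ⟩
          r * 0# + (coeff same σ + coeff others σ)
            ≈⟨ +-cong (zeroʳ r) (+-congʳ (coeff-outside s∼-resp same in-same ¬s∼σ)) ⟩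
          0# + (0# + coeff others σ)                 ≈⟨ trans (+-identityˡ _) (+-identityˡ _) ⟩
          coeff others σ                             ∎)

        vanish-others : ⟪ others ⟫ h ≈ 0#
        vanish-others = ⟪⟫≈0-bounded n others h (ℕ.≤-trans (List.length-filter (¬? ∘ same?) xs) len) h-resp
          (All.zipWith (λ { (¬s∼σ , inj₁ c≈0) → inj₁ (trans (coeff-others ¬s∼σ) c≈0) ; (_ , inj₂ h≈0) → inj₂ h≈0 })
            (in-others , All.filter⁺ (¬? ∘ same?) hyp))

    vanishesOnSupport⇒⟪⟫≈0 : ∀ xs h → Respects h → VanishesOnSupport h xs → ⟪ xs ⟫ h ≈ 0#
    vanishesOnSupport⇒⟪⟫≈0 xs h = ⟪⟫≈0-bounded (length xs) xs h ℕ.≤-refl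

module _ (G : Graph) where
  open Graph G

  Near : Fin N → Fin N → Set
  Near u v = u ≡ v ⊎ Adj u v

  near-sym : ∀ {u v} → Near u v → Near v u
  near-sym (inj₁ u≡v) = inj₁ (≡.sym u≡v)
  near-sym (inj₂ adj) = inj₂ (adj-sym adj)

  record Contraction : Set where
    field
      φ             : Fin N → Fin N
      centre        : Fin N
      φ-hom         : ∀ {u v} → Near u v → Near (φ u) (φ v)
      near-φ        : ∀ v → Near v (φ v)
      centre-near-φ : ∀ v → Near centre (φ v)

  edgeContraction : (K : Subset N) (a b : Fin N) → Adj a b →
    (∀ v → v ∈ K → Adj v b) → (∀ v → ¬ v ∈ K → Adj v a) → Contraction
  edgeContraction K a b a~b K~b outside~a = record
    { φ             = φ
    ; centre        = a
    ; φ-hom         = λ {u} {v} _ → φ-near u v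
    ; near-φ        = near-φ
    ; centre-near-φ = centre-near-φ
    }
    where
    φ : Fin N → Fin N
    φ v with v ∈? K
    ... | yes _ = b
    ... | no  _ = a

    near-φ : ∀ v → Near v (φ v)
    near-φ v with v ∈? K
    ... | yes v∈K = inj₂ (K~b v v∈K)
    ... | no  v∉K = inj₂ (outside~a v v∉K)

    φ-near : ∀ u v → Near (φ u) (φ v)
    φ-near u v with u ∈? K | v ∈? K
    ... | yes _ | yes _ = inj₁ ≡.refl
    ... | yes _ | no  _ = inj₂ (adj-sym a~b)
    ... | no  _ | yes _ = inj₂ a~b
    ... | no  _ | no  _ = inj₁ ≡.refl

    centre-near-φ : ∀ v → Near a (φ v)
    centre-near-φ v with v ∈? K
    ... | yes _ = inj₂ a~b
    ... | no  _ = inj₁ ≡.refl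

module PathContraction {c ℓ} (R : CommutativeRing c ℓ) (G : Graph) (κ : Contraction G) where

  open CommutativeRing R hiding (zero)
  open import Algebra.Properties.Ring ring using (-1*x≈-x)
  open import Algebra.Properties.Group +-group using (ε⁻¹≈ε)
  open IntegerCoefficientSolver R
  open FormalSums R
  open Graph G
  open Contraction κ
  open Homology R G
  open import Relation.Binary.Reasoning.Setoid setoid

  Cochain : ℕ → Set c
  Cochain k = Vec V k → Carrier

  faces : ∀ {k} → Vec V (suc k) → FormalSum (Vec V k)
  faces {k} v = map (λ j → (psgn (toℕ j) , removeAt v j)) (allFin (suc k))

  δ : ∀ {k} → Cochain k → Cochain (suc k)
  δ g v = ⟪ faces v ⟫ g

  ⟪⟫-∂P : ∀ {m} (x : PChain (suc m)) g → ⟪ ∂P x ⟫ g ≈ ⟪ x ⟫ (δ g)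
  ⟪⟫-∂P         []            g = refl
  ⟪⟫-∂P {m} ((r , v) ∷ x) g = trans (⟪⟫-++ (weighted (allFin _)) _ g) (+-cong (⟪weighted⟫ (allFin _)) (⟪⟫-∂P x g))
    where
    weighted : List (Fin (suc (suc m))) → FormalSum (Vec V (suc m))
    weighted = map (λ j → (psgn (toℕ j) * r , removeAt v j))
    ⟪weighted⟫ : ∀ js → ⟪ weighted js ⟫ g ≈ r * ⟪ map (λ j → (psgn (toℕ j) , removeAt v j)) js ⟫ g
    ⟪weighted⟫ []       = sym (zeroʳ r)
    ⟪weighted⟫ (j ∷ js) = trans (+-congˡ (⟪weighted⟫ js))
      (solve 4 (λ p r x u → p :* r :* x :+ r :* u := r :* (p :* x :+ u)) refl (psgn (toℕ j)) r _ _)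

  δ-cong : ∀ {k} (v : Vec V (suc k)) {g h : Cochain k} → (∀ s → g s ≈ h s) → δ g v ≈ δ h v
  δ-cong v = ⟪⟫-cong (faces v)

  δ-[] : ∀ u (g : Cochain 0) → δ g (u ∷ []) ≈ g []
  δ-[] u g = trans (+-identityʳ _) (*-identityˡ _)

  δ-∷ : ∀ {k} u (w : Vec V (suc k)) g → δ g (u ∷ w) ≈ g w - δ (g ∘ (u ∷_)) w
  δ-∷ {k} u w g = +-cong (*-identityˡ _) (tail id w)
    where
    -- allFin (suc (suc k)) unfolds to zero ∷ tabulate suc.
    tail : ∀ {n} (h : Fin n → Fin (suc k)) (w : Vec V (suc k)) →
      ⟪ map (λ j → (psgn (toℕ j) , removeAt (u ∷ w) j)) (tabulate (suc ∘ h)) ⟫ g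
        ≈ - ⟪ map (λ j → (psgn (toℕ j) , removeAt w j)) (tabulate h) ⟫ (g ∘ (u ∷_))
    tail {zero}  h (w₀ ∷ w) = sym ε⁻¹≈ε
    tail {suc n} h (w₀ ∷ w) = trans (+-congˡ (tail (h ∘ suc) (w₀ ∷ w)))
      (solve 3 (λ p x r → (:- p) :* x :+ (:- r) := :- (p :* x :+ r)) refl (psgn (toℕ (h zero))) _ _)

  vφ : ∀ {k} → Vec V k → Vec V k
  vφ = Vec.map φ

  δ-vφ : ∀ {k} (v : Vec V (suc k)) (g : Cochain k) → δ g (vφ v) ≈ δ (g ∘ vφ) v
  δ-vφ {k} v g = go (allFin (suc k))
    where
    removeAt-vφ : ∀ {k} (v : Vec V (suc k)) j → removeAt (vφ v) j ≡ vφ (removeAt v j)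
    removeAt-vφ (x ∷ v)     zero    = ≡.refl
    removeAt-vφ (x ∷ y ∷ v) (suc j) = ≡.cong (φ x ∷_) (removeAt-vφ (y ∷ v) j)
    go : ∀ js → ⟪ map (λ j → (psgn (toℕ j) , removeAt (vφ v) j)) js ⟫ g
              ≈ ⟪ map (λ j → (psgn (toℕ j) , removeAt v j)) js ⟫ (g ∘ vφ)
    go []       = refl
    go (j ∷ js) = +-cong (*-congˡ (reflexive (≡.cong g (removeAt-vφ v j)))) (go js)

  -- prism (v₀ … vₙ) = Σᵢ (-1)ⁱ (v₀ … vᵢ φvᵢ … φvₙ)
  prism : ∀ {k} → Vec V k → FormalSum (Vec V (suc k))
  prism []      = []
  prism (t₀ ∷ t) = (1# , t₀ ∷ φ t₀ ∷ vφ t) ∷ scale (- 1#) (rename (t₀ ∷_) (prism t))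

  prism* : ∀ {k} → Cochain (suc k) → Cochain k
  prism* g t = ⟪ prism t ⟫ g

  prism*-∷ : ∀ {k} t₀ (t : Vec V k) g → prism* g (t₀ ∷ t) ≈ g (t₀ ∷ φ t₀ ∷ vφ t) - prism* (g ∘ (t₀ ∷_)) t
  prism*-∷ t₀ t g = +-cong (*-identityˡ _) (begin
    ⟪ scale (- 1#) (rename (t₀ ∷_) (prism t)) ⟫ g ≈⟨ ⟪⟫-scale (- 1#) (rename (t₀ ∷_) (prism t)) g ⟩
    - 1# * ⟪ rename (t₀ ∷_) (prism t) ⟫ g         ≈⟨ *-congˡ (reflexive (⟪⟫-rename (t₀ ∷_) (prism t) g)) ⟩
    - 1# * prism* (g ∘ (t₀ ∷_)) t                 ≈⟨ -1*x≈-x _ ⟩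
    - prism* (g ∘ (t₀ ∷_)) t                      ∎)

  prism-homotopy : ∀ {k} (t : Vec V (suc k)) (g : Cochain (suc k)) →
    prism* (δ g) t + δ (prism* g) t ≈ g (vφ t) - g t
  prism-homotopy (t₀ ∷ []) g = begin
    prism* (δ g) (t₀ ∷ []) + δ (prism* g) (t₀ ∷ [])  ≈⟨ +-cong (prism*-∷ t₀ [] (δ g)) (δ-[] t₀ (prism* g)) ⟩
    (δ g (t₀ ∷ φ t₀ ∷ []) - 0#) + 0#                  ≈⟨ +-congʳ (+-congˡ ε⁻¹≈ε) ⟩
    (δ g (t₀ ∷ φ t₀ ∷ []) + 0#) + 0#                  ≈⟨ trans (+-identityʳ _) (+-identityʳ _) ⟩
    δ g (t₀ ∷ φ t₀ ∷ [])                              ≈⟨ δ-∷ t₀ (φ t₀ ∷ []) g ⟩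
    g (φ t₀ ∷ []) - δ (g ∘ (t₀ ∷_)) (φ t₀ ∷ [])       ≈⟨ +-congˡ (-‿cong (δ-[] (φ t₀) (g ∘ (t₀ ∷_)))) ⟩
    g (φ t₀ ∷ []) - g (t₀ ∷ [])                       ∎
  prism-homotopy (t₀ ∷ t@(_ ∷ _)) g = begin
    prism* (δ g) (t₀ ∷ t) + δ (prism* g) (t₀ ∷ t)
      ≈⟨ +-cong (prism*-∷ t₀ t (δ g)) (δ-∷ t₀ t (prism* g)) ⟩
    (δ g (t₀ ∷ φ t₀ ∷ vφ t) - prism* (δ g ∘ (t₀ ∷_)) t) + (prism* g t - δ (prism* g ∘ (t₀ ∷_)) t)
      ≈⟨ +-cong (+-cong δg-at-cylinder-top (-‿cong prism*-δg-tail)) (+-congˡ (-‿cong δ-prism*-tail)) ⟩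
    ((A - (B - C)) - (D - E)) + (D - (C - F))
      ≈⟨ solve 6 (λ A B C D E F → ((A :- (B :- C)) :- (D :- E)) :+ (D :- (C :- F)) := (A :- B) :+ (E :+ F))
               refl A B C D E F ⟩
    (A - B) + (E + F)              ≈⟨ +-congˡ (prism-homotopy t h) ⟩
    (A - B) + (B - h t)            ≈⟨ solve 3 (λ A B H → (A :- B) :+ (B :- H) := A :- H) refl A B (h t) ⟩
    g (vφ (t₀ ∷ t)) - g (t₀ ∷ t)   ∎
    where
    h : Cochain (suc _)
    h = g ∘ (t₀ ∷_)
    A B C D E F : Carrier
    A = g (vφ (t₀ ∷ t))
    B = h (vφ t)
    C = δ (g ∘ (t₀ ∷_) ∘ (φ t₀ ∷_)) (vφ t)
    D = prism* g t
    E = prism* (δ h) t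
    F = δ (prism* h) t
    δg-at-cylinder-top : δ g (t₀ ∷ φ t₀ ∷ vφ t) ≈ A - (B - C)
    δg-at-cylinder-top = trans (δ-∷ t₀ _ g) (+-congˡ (-‿cong (δ-∷ (φ t₀) (vφ t) h)))
    prism*-δg-tail : prism* (δ g ∘ (t₀ ∷_)) t ≈ D - E
    prism*-δg-tail = trans (⟪⟫-cong (prism t) (λ { s@(_ ∷ _) → δ-∷ t₀ s g })) (⟪⟫-sub (prism t) g _)
    δ-prism*-tail : δ (prism* g ∘ (t₀ ∷_)) t ≈ C - F
    δ-prism*-tail = begin
      δ (prism* g ∘ (t₀ ∷_)) t                                   ≈⟨ δ-cong t (λ s → prism*-∷ t₀ s g) ⟩
      δ (λ s → g (t₀ ∷ φ t₀ ∷ vφ s) - prism* h s) t              ≈⟨ ⟪⟫-sub (faces t) _ _ ⟩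
      δ (g ∘ (t₀ ∷_) ∘ (φ t₀ ∷_) ∘ vφ) t - F                     ≈⟨ +-congʳ (sym (δ-vφ t _)) ⟩
      C - F                                                      ∎

  contraction : ∀ {k} → Vec V k → FormalSum (Vec V (suc k))
  contraction t = (1# , centre ∷ vφ t) ∷ scale (- 1#) (prism t)

  contraction* : ∀ {k} → Cochain (suc k) → Cochain k
  contraction* g t = ⟪ contraction t ⟫ g

  contraction*-def : ∀ {k} (t : Vec V k) g → contraction* g t ≈ g (centre ∷ vφ t) - prism* g t
  contraction*-def t g = +-cong (*-identityˡ _) (trans (⟪⟫-scale (- 1#) (prism t) g) (-1*x≈-x _))

  -- The transpose of ∂ ∘ contraction + contraction ∘ ∂ = id.
  contraction-homotopy : ∀ {k} (σ : Vec V (suc k)) (g : Cochain (suc k)) →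
    contraction* (δ g) σ ≈ g σ - δ (contraction* g) σ
  contraction-homotopy σ g = begin
    contraction* (δ g) σ
      ≈⟨ contraction*-def σ (δ g) ⟩
    δ g (centre ∷ vφ σ) - prism* (δ g) σ
      ≈⟨ +-cong (trans (δ-∷ centre (vφ σ) g) (+-congˡ (-‿cong (δ-vφ σ _)))) (-‿cong prism*-δg) ⟩
    (A - B) - ((A - S) - P)
      ≈⟨ solve 4 (λ A B S P → (A :- B) :- ((A :- S) :- P) := S :- (B :- P)) refl A B S P ⟩
    S - (B - P)
      ≈⟨ +-congˡ (-‿cong (sym (trans (δ-cong σ (λ s → contraction*-def s g)) (⟪⟫-sub (faces σ) _ _)))) ⟩
    g σ - δ (contraction* g) σ ∎
    where
    A B S P : Carrier
    A = g (vφ σ)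
    B = δ (λ s → g (centre ∷ vφ s)) σ
    S = g σ
    P = δ (prism* g) σ
    prism*-δg : prism* (δ g) σ ≈ (A - S) - P
    prism*-δg = begin
      prism* (δ g) σ             ≈⟨ solve 2 (λ x y → x := (x :+ y) :- y) refl _ P ⟩
      (prism* (δ g) σ + P) - P   ≈⟨ +-congʳ (prism-homotopy σ g) ⟩
      (A - S) - P                ∎

  NearWalk : ∀ {k} → Vec V k → Set
  NearWalk []           = ⊤
  NearWalk (x ∷ [])     = ⊤
  NearWalk (x ∷ y ∷ xs) = Near G x y × NearWalk (y ∷ xs)

  Irregular : ∀ {k} → Vec V k → Set
  Irregular []           = ⊥
  Irregular (x ∷ [])     = ⊥
  Irregular (x ∷ y ∷ xs) = x ≡ y ⊎ Irregular (y ∷ xs)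

  irregular⊎regular : ∀ {k} (t : Vec V k) → Irregular t ⊎ Regular t
  irregular⊎regular []           = inj₂ tt
  irregular⊎regular (x ∷ [])     = inj₂ tt
  irregular⊎regular (x ∷ y ∷ xs) with x ≟ y | irregular⊎regular (y ∷ xs)
  ... | yes x≡y | _       = inj₁ (inj₁ x≡y)
  ... | no  _   | inj₁ ir = inj₁ (inj₂ ir)
  ... | no  x≢y | inj₂ re = inj₂ (x≢y , re)

  regular⇒¬irregular : ∀ {k} (t : Vec V k) → Regular t → ¬ Irregular t
  regular⇒¬irregular (x ∷ y ∷ xs) (x≢y , re) (inj₁ x≡y) = x≢y x≡y
  regular⇒¬irregular (x ∷ y ∷ xs) (x≢y , re) (inj₂ ir)  = regular⇒¬irregular (y ∷ xs) re ir

  regular∧nearWalk⇒allowed : ∀ {k} (t : Vec V k) → Regular t → NearWalk t → Allowed t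
  regular∧nearWalk⇒allowed []           _          _                = tt
  regular∧nearWalk⇒allowed (x ∷ [])     _          _                = tt
  regular∧nearWalk⇒allowed (x ∷ y ∷ xs) (x≢y , re) (inj₁ x≡y , w)   = contradiction x≡y x≢y
  regular∧nearWalk⇒allowed (x ∷ y ∷ xs) (x≢y , re) (inj₂ adj , w)   = adj , regular∧nearWalk⇒allowed (y ∷ xs) re w

  allowed⇒nearWalk : ∀ {k} (t : Vec V k) → Allowed t → NearWalk t
  allowed⇒nearWalk []           _          = tt
  allowed⇒nearWalk (x ∷ [])     _          = tt
  allowed⇒nearWalk (x ∷ y ∷ xs) (adj , al) = inj₂ adj , allowed⇒nearWalk (y ∷ xs) al

  allowed? : ∀ {k} (t : Vec V k) → Dec (Allowed t)
  allowed? []           = yes tt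
  allowed? (x ∷ [])     = yes tt
  allowed? (x ∷ y ∷ xs) = adj? x y ×-dec allowed? (y ∷ xs)

  nearWalk-vφ : ∀ {k} (t : Vec V k) → NearWalk t → NearWalk (vφ t)
  nearWalk-vφ []           _       = tt
  nearWalk-vφ (x ∷ [])     _       = tt
  nearWalk-vφ (x ∷ y ∷ xs) (n , w) = φ-hom n , nearWalk-vφ (y ∷ xs) w

  irregular-vφ : ∀ {k} (t : Vec V k) → Irregular t → Irregular (vφ t)
  irregular-vφ (x ∷ y ∷ xs) (inj₁ x≡y) = inj₁ (≡.cong φ x≡y)
  irregular-vφ (x ∷ y ∷ xs) (inj₂ ir)  = inj₂ (irregular-vφ (y ∷ xs) ir)

  prism-head : ∀ {k} t₀ (t : Vec V k) → AllGen (λ s → Vec.head s ≡ t₀) (prism (t₀ ∷ t))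
  prism-head t₀ t = ≡.refl ∷ AllGen-scale (- 1#) (AllGen-rename (λ _ → ≡.refl) (All.universal (λ _ → tt) (prism t)))

  prism-nearWalk : ∀ {k} (t : Vec V k) → NearWalk t → AllGen NearWalk (prism t)
  prism-nearWalk []             _         = []
  prism-nearWalk (t₀ ∷ [])      _         = (near-φ t₀ , tt) ∷ []
  prism-nearWalk (t₀ ∷ t₁ ∷ ts) (n₀₁ , w) =
    (near-φ t₀ , nearWalk-vφ (t₀ ∷ t₁ ∷ ts) (n₀₁ , w)) ∷
    AllGen-scale (- 1#) (AllGen-rename extend (All.zip (prism-head t₁ ts , prism-nearWalk (t₁ ∷ ts) w)))
    where
    extend : ∀ {s} → Vec.head s ≡ t₁ × NearWalk s → NearWalk (t₀ ∷ s)
    extend {_ ∷ _} (≡.refl , w′) = n₀₁ , w′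

  irregular-∷ : ∀ {k} x {s : Vec V k} → Irregular s → Irregular (x ∷ s)
  irregular-∷ x {_ ∷ _} ir = inj₂ ir

  prism-irregular : ∀ {k} (t : Vec V k) → Irregular t → AllGen Irregular (prism t)
  prism-irregular t@(t₀ ∷ t₁ ∷ ts) (inj₁ t₀≡t₁) =
    inj₂ (irregular-vφ t (inj₁ t₀≡t₁)) ∷ AllGen-scale (- 1#) (AllGen-rename repeat (prism-head t₁ ts))
    where
    repeat : ∀ {s} → Vec.head s ≡ t₁ → Irregular (t₀ ∷ s)
    repeat {_ ∷ _} ≡.refl = inj₁ t₀≡t₁
  prism-irregular t@(t₀ ∷ t₁ ∷ ts) (inj₂ ir) =
    inj₂ (irregular-vφ t (inj₂ ir)) ∷ AllGen-scale (- 1#) (AllGen-rename (irregular-∷ t₀) (prism-irregular (t₁ ∷ ts) ir))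

  contraction-nearWalk : ∀ {k} (t : Vec V (suc k)) → NearWalk t → AllGen NearWalk (contraction t)
  contraction-nearWalk (t₀ ∷ t) w =
    (centre-near-φ t₀ , nearWalk-vφ (t₀ ∷ t) w) ∷ AllGen-scale (- 1#) (prism-nearWalk (t₀ ∷ t) w)

  contraction-irregular : ∀ {k} (t : Vec V k) → Irregular t → AllGen Irregular (contraction t)
  contraction-irregular t@(_ ∷ _ ∷ _) ir = inj₂ (irregular-vφ t ir) ∷ AllGen-scale (- 1#) (prism-irregular t ir)

  tuples : ℕ → DecSetoid 0ℓ 0ℓ
  tuples k = decSetoid (≡-dec {n = k} (_≟_ {N}))

  module Tuples {k} = Coefficients (tuples k)

  coeffP≈coeff : ∀ {n} (x : PChain n) t → coeffP x t ≈ Tuples.coeff x t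
  coeffP≈coeff []            t = refl
  coeffP≈coeff ((r , v) ∷ x) t = +-cong (trans (reflexive (≡.cong (if_then r else 0#) (isYes≗does v≟t)))
                                               (if-then-0≈*𝟙 v≟t r))
                                        (coeffP≈coeff x t)
    where
    v≟t : Dec (v ≡ t)
    v≟t = ≡-dec _≟_ v t

  chain-homotopy : ∀ {m} (x : PChain (suc m)) g →
    ⟪ ∂P (bind contraction x) ⟫ g ≈ ⟪ x ⟫ g - ⟪ ∂P x ⟫ (contraction* g)
  chain-homotopy x g = begin
    ⟪ ∂P (bind contraction x) ⟫ g                 ≈⟨ ⟪⟫-∂P (bind contraction x) g ⟩
    ⟪ bind contraction x ⟫ (δ g)                  ≈⟨ ⟪⟫-bind contraction x (δ g) ⟩
    ⟪ x ⟫ (contraction* (δ g))                    ≈⟨ ⟪⟫-cong x (λ σ → contraction-homotopy σ g) ⟩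
    ⟪ x ⟫ (λ σ → g σ - δ (contraction* g) σ)      ≈⟨ ⟪⟫-sub x g _ ⟩
    ⟪ x ⟫ g - ⟪ x ⟫ (δ (contraction* g))          ≈⟨ +-congˡ (-‿cong (sym (⟪⟫-∂P x _))) ⟩
    ⟪ x ⟫ g - ⟪ ∂P x ⟫ (contraction* g)           ∎

  coeff-contraction-irregular : ∀ {k} {τ : Vec V (suc k)} → Regular τ → ∀ s → Irregular s →
    Tuples.coeff (contraction s) τ ≈ 0#
  coeff-contraction-irregular {τ = τ} reg s ir =
    Tuples.coeff-outside (≡.subst Irregular) (contraction s) (contraction-irregular s ir) (regular⇒¬irregular τ reg)

  contraction-cycle : ∀ {m} (x : PChain (suc m)) → ∂P x ≈P [] → ∂P (bind contraction x) ≈P x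
  contraction-cycle {m} x x-cycle τ reg = begin
    coeffP (∂P (bind contraction x)) τ  ≈⟨ coeffP≈coeff (∂P (bind contraction x)) τ ⟩
    ⟪ ∂P (bind contraction x) ⟫ 𝟙τ      ≈⟨ chain-homotopy x 𝟙τ ⟩
    ⟪ x ⟫ 𝟙τ - ⟪ ∂P x ⟫ h               ≈⟨ +-congˡ (-‿cong ∂x-vanishes) ⟩
    ⟪ x ⟫ 𝟙τ - 0#                       ≈⟨ trans (+-congˡ ε⁻¹≈ε) (+-identityʳ _) ⟩
    ⟪ x ⟫ 𝟙τ                            ≈⟨ sym (coeffP≈coeff x τ) ⟩
    coeffP x τ                          ∎
    where
    𝟙τ : Cochain (suc (suc m))
    𝟙τ σ = 𝟙[ ≡-dec _≟_ σ τ ]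
    h : Cochain (suc m)
    h = contraction* 𝟙τ
    pick : ∀ ((_ , s) : Carrier × Vec V (suc m)) → Tuples.coeff (∂P x) s ≈ 0# ⊎ h s ≈ 0#
    pick (_ , s) with irregular⊎regular s
    ... | inj₁ ir = inj₂ (coeff-contraction-irregular reg s ir)
    ... | inj₂ re = inj₁ (trans (sym (coeffP≈coeff (∂P x) s)) (x-cycle s re))
    ∂x-vanishes : ⟪ ∂P x ⟫ h ≈ 0#
    ∂x-vanishes = Tuples.vanishesOnSupport⇒⟪⟫≈0 (∂P x) h (reflexive ∘ ≡.cong h) (All.universal pick (∂P x))

  contraction-allowed : ∀ {n} (x : PChain n) → InAllowed x → InAllowed (bind contraction x)
  contraction-allowed {n} x x-allowed τ reg ¬al = begin
    coeffP (bind contraction x) τ  ≈⟨ coeffP≈coeff (bind contraction x) τ ⟩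
    ⟪ bind contraction x ⟫ 𝟙τ      ≈⟨ ⟪⟫-bind contraction x 𝟙τ ⟩
    ⟪ x ⟫ h                        ≈⟨ Tuples.vanishesOnSupport⇒⟪⟫≈0 x h (reflexive ∘ ≡.cong h) (All.universal pick x) ⟩
    0#                             ∎
    where
    𝟙τ : Cochain (suc (suc n))
    𝟙τ σ = 𝟙[ ≡-dec _≟_ σ τ ]
    h : Cochain (suc n)
    h = contraction* 𝟙τ
    pick : ∀ ((_ , s) : Carrier × Vec V (suc n)) → Tuples.coeff x s ≈ 0# ⊎ h s ≈ 0#
    pick (_ , s) with irregular⊎regular s
    ... | inj₁ ir = inj₂ (coeff-contraction-irregular reg s ir)
    ... | inj₂ re with allowed? s
    ...   | yes al   = inj₂ (Tuples.coeff-outside (≡.subst NearWalk) (contraction s)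
                         (contraction-nearWalk s (allowed⇒nearWalk s al)) (¬al ∘ regular∧nearWalk⇒allowed τ reg))
    ...   | no  ¬al′ = inj₁ (trans (sym (coeffP≈coeff x s)) (x-allowed s re ¬al′))

  pathHomologyVanishes : ∀ m → PathHomologyVanishes m
  pathHomologyVanishes m x (x-allowed , _) x-cycle =
    bind contraction x , (contraction-allowed x x-allowed , ∂y-allowed) , contraction-cycle x x-cycle
    where
    ∂y-allowed : InAllowed (∂P (bind contraction x))
    ∂y-allowed τ reg ¬al = trans (contraction-cycle x x-cycle τ reg) (x-allowed τ reg ¬al)

module CubeContraction {c ℓ} (R : CommutativeRing c ℓ) (G : Graph) (κ : Contraction G) where

  open CommutativeRing R hiding (zero)
  open import Algebra.Properties.Ring ring using (-1*x≈-x)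
  open import Algebra.Properties.Group +-group using (ε⁻¹≈ε; ⁻¹-involutive)
  open IntegerCoefficientSolver R
  open FormalSums R
  open Graph G
  open Contraction κ
  open Homology R G
  open import Relation.Binary.Reasoning.Setoid setoid

  allTrue-sound : ∀ {X : Set} (p : X → Bool) {xs x} → T (allTrue p xs) → x Membership.∈ xs → T (p x)
  allTrue-sound p t (here ≡.refl) = proj₁ (Equivalence.to T-∧ t)
  allTrue-sound p t (there x∈xs)  = allTrue-sound p (proj₂ (Equivalence.to T-∧ t)) x∈xs

  allTrue-complete : ∀ {X : Set} (p : X → Bool) xs → (∀ x → T (p x)) → T (allTrue p xs)
  allTrue-complete p []       all-p = _
  allTrue-complete p (x ∷ xs) all-p = Equivalence.from T-∧ (all-p x , allTrue-complete p xs all-p)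

  ∈-allBits : ∀ {n} (x : Vec Bool n) → x Membership.∈ allBits n
  ∈-allBits []          = here ≡.refl
  ∈-allBits (false ∷ x) = ∈-++⁺ˡ (∈-map⁺ (false ∷_) (∈-allBits x))
  ∈-allBits (true  ∷ x) = ∈-++⁺ʳ _ (∈-map⁺ (true ∷_) (∈-allBits x))

  _≗?_ : ∀ {n} (σ τ : CMap n) → Dec (σ ≗ τ)
  _≗?_ {n} σ τ = map′ (λ t x → toWitness (allTrue-sound agree t (∈-allBits x)))
                      (λ σ≗τ → allTrue-complete agree (allBits n) (λ x → fromWitness (σ≗τ x)))
                      (T? (sameMap σ τ))
    where
    agree : Vec Bool n → Bool
    agree x = ⌊ σ x ≟ τ x ⌋

  cubes : ℕ → DecSetoid 0ℓ 0ℓ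
  cubes n = record
    { Carrier          = CMap n
    ; _≈_              = _≗_
    ; isDecEquivalence = record
      { isEquivalence = record
        { refl  = λ _ → ≡.refl
        ; sym   = λ σ≗τ x → ≡.sym (σ≗τ x)
        ; trans = λ σ≗τ τ≗ρ x → ≡.trans (σ≗τ x) (τ≗ρ x)
        }
      ; _≟_ = _≗?_
      }
    }

  module Cubes {n} = Coefficients (cubes n)
  open Cubes using (Respects)

  coeffC≈coeff : ∀ {n} (x : CChain n) τ → coeffC x τ ≈ Cubes.coeff x τ
  coeffC≈coeff []            τ = refl
  coeffC≈coeff ((r , σ) ∷ x) τ = +-cong (if-then-0≈*𝟙 (σ ≗? τ) r) (coeffC≈coeff x τ)

  Cochain : ℕ → Set c
  Cochain n = CMap n → Carrier

  facePair : ∀ {m} → CMap (suc m) → Fin (suc m) → FormalSum (CMap m)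
  facePair σ j = (sgn (toℕ j) , face j false σ) ∷ (- sgn (toℕ j) , face j true σ) ∷ []

  faces : ∀ {m} → CMap (suc m) → FormalSum (CMap m)
  faces {m} σ = concatMap (facePair σ) (allFin (suc m))

  δ : ∀ {m} → Cochain m → Cochain (suc m)
  δ g σ = ⟪ faces σ ⟫ g

  ⟪⟫-∂C : ∀ {m} (x : CChain (suc m)) g → ⟪ ∂C x ⟫ g ≈ ⟪ x ⟫ (δ g)
  ⟪⟫-∂C         []            g = refl
  ⟪⟫-∂C {m} ((r , σ) ∷ x) g = trans (⟪⟫-++ (weighted (allFin _)) _ g) (+-cong (⟪weighted⟫ (allFin _)) (⟪⟫-∂C x g))
    where
    weighted : List (Fin (suc m)) → FormalSum (CMap m)
    weighted = concatMap (λ j → (sgn (toℕ j) * r , face j false σ) ∷ (- (sgn (toℕ j) * r) , face j true σ) ∷ [])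
    ⟪weighted⟫ : ∀ js → ⟪ weighted js ⟫ g ≈ r * ⟪ concatMap (facePair σ) js ⟫ g
    ⟪weighted⟫ []       = sym (zeroʳ r)
    ⟪weighted⟫ (j ∷ js) = trans (+-congˡ (+-congˡ (⟪weighted⟫ js)))
      (solve 5 (λ s r x y u → s :* r :* x :+ ((:- (s :* r)) :* y :+ r :* u) := r :* (s :* x :+ ((:- s) :* y :+ u)))
             refl (sgn (toℕ j)) r _ _ _)

  δ-∘ : ∀ {m} (k : V → V) (σ : CMap (suc m)) (g : Cochain m) → δ g (k ∘ σ) ≡ δ (g ∘ (k ∘_)) σ
  δ-∘ {m} k σ g = go (allFin (suc m))
    where
    go : ∀ js → ⟪ concatMap (facePair (k ∘ σ)) js ⟫ g ≡ ⟪ concatMap (facePair σ) js ⟫ (g ∘ (k ∘_))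
    go []       = ≡.refl
    go (j ∷ js) = ≡.cong (λ z → _ + (_ + z)) (go js)

  cylinder : ∀ {n} → (V → V) → CMap n → CMap (suc n)
  cylinder k σ (false ∷ x) = σ x
  cylinder k σ (true  ∷ x) = k (σ x)

  cylinder-cong : ∀ {n} (k : V → V) {σ τ : CMap n} → σ ≗ τ → cylinder k σ ≗ cylinder k τ
  cylinder-cong k σ≗τ (false ∷ x) = σ≗τ x
  cylinder-cong k σ≗τ (true  ∷ x) = ≡.cong k (σ≗τ x)

  δ-cylinder : ∀ {m} (k : V → V) (σ : CMap (suc m)) g → Respects g →
    δ g (cylinder k σ) ≈ (g (k ∘ σ) - g σ) - δ (g ∘ cylinder k) σ
  δ-cylinder {m} k σ g g-resp = begin
    - 1# * g σ + (- - 1# * g (k ∘ σ) + ⟪ tail′ (tabulate suc) ⟫ g)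
      ≈⟨ +-cong (-1*x≈-x _) (+-cong (*-congʳ (⁻¹-involutive 1#)) (tail id)) ⟩
    - g σ + (1# * g (k ∘ σ) + - δ (g ∘ cylinder k) σ)
      ≈⟨ solve 3 (λ S K T → (:- S) :+ (K :+ (:- T)) := (K :- S) :- T) refl (g σ) (1# * g (k ∘ σ)) _ ⟩
    (1# * g (k ∘ σ) - g σ) - δ (g ∘ cylinder k) σ
      ≈⟨ +-congʳ (+-congʳ (*-identityˡ _)) ⟩
    (g (k ∘ σ) - g σ) - δ (g ∘ cylinder k) σ ∎
    where
    tail′ : List (Fin (suc (suc m))) → FormalSum (CMap (suc m))
    tail′ = concatMap (facePair (cylinder k σ))
    tail : ∀ {n} (h : Fin n → Fin (suc m)) →
      ⟪ tail′ (tabulate (suc ∘ h)) ⟫ g ≈ - ⟪ concatMap (facePair σ) (tabulate h) ⟫ (g ∘ cylinder k)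
    tail {zero}  h = sym ε⁻¹≈ε
    tail {suc n} h = trans
      (+-cong (*-congˡ (g-resp (face-cylinder false))) (+-cong (*-congˡ (g-resp (face-cylinder true))) (tail (h ∘ suc))))
      (solve 4 (λ s x y u → (:- s) :* x :+ ((:- (:- s)) :* y :+ (:- u)) := :- (s :* x :+ ((:- s) :* y :+ u)))
             refl (sgn (toℕ (h zero))) _ _ _)
      where
      face-cylinder : ∀ ε → face (suc (h zero)) ε (cylinder k σ) ≗ cylinder k (face (h zero) ε σ)
      face-cylinder ε (false ∷ x) = ≡.refl
      face-cylinder ε (true  ∷ x) = ≡.refl

  contraction : ∀ {n} → CMap n → FormalSum (CMap (suc n))
  contraction σ = (- 1# , cylinder φ σ) ∷ (- 1# , cylinder (const centre) (φ ∘ σ)) ∷ []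

  contraction* : ∀ {n} → Cochain (suc n) → Cochain n
  contraction* g σ = ⟪ contraction σ ⟫ g

  contraction*-def : ∀ {n} (g : Cochain (suc n)) σ →
    contraction* g σ ≈ - (g (cylinder φ σ) + g (cylinder (const centre) (φ ∘ σ)))
  contraction*-def g σ = begin
    - 1# * g (cylinder φ σ) + (- 1# * g (cylinder (const centre) (φ ∘ σ)) + 0#)
      ≈⟨ +-cong (-1*x≈-x _) (trans (+-identityʳ _) (-1*x≈-x _)) ⟩
    - g (cylinder φ σ) + - g (cylinder (const centre) (φ ∘ σ))
      ≈⟨ solve 2 (λ a b → (:- a) :+ (:- b) := :- (a :+ b)) refl _ _ ⟩
    - (g (cylinder φ σ) + g (cylinder (const centre) (φ ∘ σ))) ∎

  contraction*-resp : ∀ {n} {g : Cochain (suc n)} → Respects g → Respects (contraction* g)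
  contraction*-resp g-resp σ≗τ = +-cong (*-congˡ (g-resp (cylinder-cong φ σ≗τ)))
    (+-congʳ (*-congˡ (g-resp (cylinder-cong (const centre) (≡.cong φ ∘ σ≗τ)))))

  contraction-homotopy : ∀ {m} (σ : CMap (suc m)) (g : Cochain (suc m)) → Respects g →
    contraction* (δ g) σ ≈ (g σ - g (const centre)) - δ (contraction* g) σ
  contraction-homotopy σ g g-resp = begin
    contraction* (δ g) σ
      ≈⟨ contraction*-def (δ g) σ ⟩
    - (δ g (cylinder φ σ) + δ g (cylinder (const centre) (φ ∘ σ)))
      ≈⟨ -‿cong (+-cong (δ-cylinder φ σ g g-resp)
                        (trans (δ-cylinder (const centre) (φ ∘ σ) g g-resp) (+-congˡ (-‿cong (reflexive (δ-∘ φ σ _)))))) ⟩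
    - (((A - S) - X) + ((C - A) - Y))
      ≈⟨ solve 5 (λ A S X C Y → :- (((A :- S) :- X) :+ ((C :- A) :- Y)) := (S :- C) :- (:- (X :+ Y))) refl A S X C Y ⟩
    (S - C) - - (X + Y)
      ≈⟨ +-congˡ (-‿cong (sym δ-contraction*)) ⟩
    (g σ - g (const centre)) - δ (contraction* g) σ ∎
    where
    A S X C Y : Carrier
    A = g (φ ∘ σ)
    S = g σ
    X = δ (g ∘ cylinder φ) σ
    C = g (const centre)
    Y = δ (λ ρ → g (cylinder (const centre) (φ ∘ ρ))) σ
    δ-contraction* : δ (contraction* g) σ ≈ - (X + Y)
    δ-contraction* = begin
      δ (contraction* g) σ                                                   ≈⟨ ⟪⟫-cong (faces σ) (contraction*-def g) ⟩
      δ (λ ρ → - (g (cylinder φ ρ) + g (cylinder (const centre) (φ ∘ ρ)))) σ ≈⟨ ⟪⟫-neg (faces σ) _ ⟩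
      - δ (λ ρ → g (cylinder φ ρ) + g (cylinder (const centre) (φ ∘ ρ))) σ   ≈⟨ -‿cong (⟪⟫-+ (faces σ) _ _) ⟩
      - (X + Y)                                                              ∎

  degenerate-resp : ∀ {n} {σ τ : CMap n} → σ ≗ τ → Degenerate σ → Degenerate τ
  degenerate-resp {suc m} σ≗τ (j , d) = j , λ x → ≡.trans (≡.sym (σ≗τ _)) (≡.trans (d x) (σ≗τ _))

  degenerate? : ∀ {n} (σ : CMap n) → Dec (Degenerate σ)
  degenerate? {zero}  σ = no λ ()
  degenerate? {suc m} σ = any? (λ j → face j true σ ≗? face j false σ)

  const-degenerate : ∀ {m} v → Degenerate {suc m} (const v)
  const-degenerate v = zero , λ _ → ≡.refl

  ∘-degenerate : ∀ {n} (k : V → V) {ρ : CMap n} → Degenerate ρ → Degenerate (k ∘ ρ)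
  ∘-degenerate {suc m} k (j , d) = j , ≡.cong k ∘ d

  cylinder-degenerate : ∀ {n} (k : V → V) {ρ : CMap n} → Degenerate ρ → Degenerate (cylinder k ρ)
  cylinder-degenerate {suc m} k (j , d) = suc j , λ { (false ∷ x) → d x ; (true ∷ x) → ≡.cong k (d x) }

  contraction-degenerate : ∀ {n} {ρ : CMap n} → Degenerate ρ → AllGen Degenerate (contraction ρ)
  contraction-degenerate d = cylinder-degenerate φ d ∷ cylinder-degenerate (const centre) (∘-degenerate φ d) ∷ []

  hamming≡0⇒≡ : ∀ {n} (x y : Vec Bool n) → hamming x y ≡ 0 → x ≡ y
  hamming≡0⇒≡ []          []          _ = ≡.refl
  hamming≡0⇒≡ (false ∷ x) (false ∷ y) h = ≡.cong (false ∷_) (hamming≡0⇒≡ x y h)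
  hamming≡0⇒≡ (true  ∷ x) (true  ∷ y) h = ≡.cong (true ∷_) (hamming≡0⇒≡ x y h)

  hamming-insertAt : ∀ {n} (x y : Vec Bool n) j ε → hamming (insertAt x j ε) (insertAt y j ε) ≡ hamming x y
  hamming-insertAt x       y        zero    false = ≡.refl
  hamming-insertAt x       y        zero    true  = ≡.refl
  hamming-insertAt (b ∷ x) (b′ ∷ y) (suc j) ε     = ≡.cong (_ ℕ.+_) (hamming-insertAt x y j ε)

  face-hom : ∀ {m} {σ : CMap (suc m)} j ε → IsHom σ → IsHom (face j ε σ)
  face-hom j ε σ-hom x y adj = σ-hom _ _ (≡.trans (hamming-insertAt x y j ε) adj)

  ∂C-hom : ∀ {m} (x : CChain (suc m)) → CubeChain x → CubeChain (∂C x)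
  ∂C-hom         []            []               = []
  ∂C-hom {m} ((r , σ) ∷ x) (σ-hom ∷ x-hom) = All.++⁺ (faces-hom (allFin (suc m))) (∂C-hom x x-hom)
    where
    faces-hom : ∀ js → AllGen IsHom
      (concatMap (λ j → (sgn (toℕ j) * r , face j false σ) ∷ (- (sgn (toℕ j) * r) , face j true σ) ∷ []) js)
    faces-hom []       = []
    faces-hom (j ∷ js) = face-hom j false σ-hom ∷ face-hom j true σ-hom ∷ faces-hom js

  cylinder-hom : ∀ {n} {k : V → V} {σ : CMap n} → (∀ {u v} → Near G u v → Near G (k u) (k v)) →
    (∀ x → Near G (σ x) (k (σ x))) → IsHom σ → IsHom (cylinder k σ)
  cylinder-hom k-hom near-k σ-hom (false ∷ x) (false ∷ y) adj = σ-hom x y adj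
  cylinder-hom k-hom near-k σ-hom (true  ∷ x) (true  ∷ y) adj = k-hom (σ-hom x y adj)
  cylinder-hom k-hom near-k σ-hom (false ∷ x) (true  ∷ y) adj
    rewrite hamming≡0⇒≡ x y (ℕ.suc-injective adj) = near-k y
  cylinder-hom k-hom near-k σ-hom (true  ∷ x) (false ∷ y) adj
    rewrite hamming≡0⇒≡ x y (ℕ.suc-injective adj) = near-sym G (near-k y)

  contraction-hom : ∀ {n} {σ : CMap n} → IsHom σ → AllGen IsHom (contraction σ)
  contraction-hom σ-hom =
    cylinder-hom φ-hom (near-φ ∘ _) σ-hom ∷
    cylinder-hom (λ _ → inj₁ ≡.refl) (near-sym G ∘ centre-near-φ ∘ _) (λ x y adj → φ-hom (σ-hom x y adj)) ∷ []

  chain-homotopy : ∀ {m} (x : CChain (suc m)) g → Respects g → g (const centre) ≈ 0# →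
    ⟪ ∂C (bind contraction x) ⟫ g ≈ ⟪ x ⟫ g - ⟪ ∂C x ⟫ (contraction* g)
  chain-homotopy x g g-resp g-centre≈0 = begin
    ⟪ ∂C (bind contraction x) ⟫ g                  ≈⟨ ⟪⟫-∂C (bind contraction x) g ⟩
    ⟪ bind contraction x ⟫ (δ g)                   ≈⟨ ⟪⟫-bind contraction x (δ g) ⟩
    ⟪ x ⟫ (contraction* (δ g))                     ≈⟨ ⟪⟫-cong x homotopy ⟩
    ⟪ x ⟫ (λ σ → g σ - δ (contraction* g) σ)       ≈⟨ ⟪⟫-sub x g _ ⟩
    ⟪ x ⟫ g - ⟪ x ⟫ (δ (contraction* g))           ≈⟨ +-congˡ (-‿cong (sym (⟪⟫-∂C x _))) ⟩
    ⟪ x ⟫ g - ⟪ ∂C x ⟫ (contraction* g)            ∎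
    where
    homotopy : ∀ σ → contraction* (δ g) σ ≈ g σ - δ (contraction* g) σ
    homotopy σ = trans (contraction-homotopy σ g g-resp)
      (+-congʳ (trans (+-congˡ (trans (-‿cong g-centre≈0) ε⁻¹≈ε)) (+-identityʳ _)))

  contraction-cycle : ∀ {m} (x : CChain (suc m)) → CubeChain x → ∂C x ≈C [] → ∂C (bind contraction x) ≈C x
  contraction-cycle {m} x x-hom x-cycle τ _ τ-nondeg = begin
    coeffC (∂C (bind contraction x)) τ  ≈⟨ coeffC≈coeff (∂C (bind contraction x)) τ ⟩
    ⟪ ∂C (bind contraction x) ⟫ 𝟙τ      ≈⟨ chain-homotopy x 𝟙τ (Cubes.𝟙-resp τ) (𝟙-no (const centre ≗? τ) centre≉τ) ⟩
    ⟪ x ⟫ 𝟙τ - ⟪ ∂C x ⟫ h               ≈⟨ +-congˡ (-‿cong ∂x-vanishes) ⟩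
    ⟪ x ⟫ 𝟙τ - 0#                       ≈⟨ trans (+-congˡ ε⁻¹≈ε) (+-identityʳ _) ⟩
    ⟪ x ⟫ 𝟙τ                            ≈⟨ sym (coeffC≈coeff x τ) ⟩
    coeffC x τ                          ∎
    where
    𝟙τ : Cochain (suc m)
    𝟙τ σ = 𝟙[ σ ≗? τ ]
    h : Cochain m
    h = contraction* 𝟙τ
    centre≉τ : ¬ const centre ≗ τ
    centre≉τ c≗τ = τ-nondeg (degenerate-resp c≗τ (const-degenerate centre))
    pick : ∀ ρ → IsHom ρ → Cubes.coeff (∂C x) ρ ≈ 0# ⊎ h ρ ≈ 0#
    pick ρ ρ-hom with degenerate? ρ
    ... | yes ρ-deg   = inj₂ (Cubes.coeff-outside degenerate-resp (contraction ρ) (contraction-degenerate ρ-deg) τ-nondeg)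
    ... | no ρ-nondeg = inj₁ (trans (sym (coeffC≈coeff (∂C x) ρ)) (x-cycle ρ ρ-hom ρ-nondeg))
    ∂x-vanishes : ⟪ ∂C x ⟫ h ≈ 0#
    ∂x-vanishes = Cubes.vanishesOnSupport⇒⟪⟫≈0 (∂C x) h (contraction*-resp (Cubes.𝟙-resp τ))
                    (All.map (λ {(_ , ρ)} → pick ρ) (∂C-hom x x-hom))

  cubeHomologyVanishes : ∀ m → CubeHomologyVanishes m
  cubeHomologyVanishes m x x-hom x-cycle =
    bind contraction x , AllGen-bind contraction-hom x-hom , contraction-cycle x x-hom x-cycle

theorem4p4 : ∀ {c ℓ} (R : CommutativeRing c ℓ) (G : Graph)
    (K₁ K₂ : Subset (Graph.N G)) (a b : Fin (Graph.N G)) →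
    (∀ v → v ∈ K₁ ⊎ v ∈ K₂) →
    (∀ v → ¬ (v ∈ K₁ × v ∈ K₂)) →
    a ∈ K₁ → b ∈ K₂ →
    Graph.Adj G a b →
    (∀ v → v ∈ K₁ → Graph.Adj G v b) →
    (∀ v → v ∈ K₂ → Graph.Adj G v a) →
    ∀ (m : ℕ) →
    Homology.PathHomologyVanishes R G m × Homology.CubeHomologyVanishes R G m
theorem4p4 R G K₁ K₂ a b cover _ _ _ a~b K₁~b K₂~a m =
  PathContraction.pathHomologyVanishes R G κ m , CubeContraction.cubeHomologyVanishes R G κ m
  where
  outside-K₁ : ∀ v → ¬ v ∈ K₁ → Graph.Adj G v a
  outside-K₁ v v∉K₁ = K₂~a v ([ ⊥-elim ∘ v∉K₁ , id ] (cover v))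
  κ : Contraction G
  κ = edgeContraction G K₁ a b a~b K₁~b outside-K₁
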